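{- $\mathrm{PL}(\mathrm{NE}^*,\veebar)$ is both bicomplete and bicomplete modulo expressive power for all pairs of team properties.
   Context: $\mathrm{PL}(\mathrm{NE}^*,\veebar)$: $\phi ::= p \mid \bot \mid \neg\phi \mid \phi\wedge\phi \mid \phi\vee\phi \mid \mathrm{NE}^* \mid \phi\veebar\phi$, on propositional teams with support $\models$ / anti-support $\models^-$: $p$ supported iff all $w\in s$ make $p$ true, anti-supported iff none do; $s\models\bot$ iff $s=\emptyset$, $\bot$ always anti-supported; $s\models\mathrm{NE}^*$ iff $s\ne\emptyset$ and $s\models^-\mathrm{NE}^*$ iff $s\ne\emptyset$; $\neg$ swaps support and anti-support; $\wedge$ supported iff both are, anti-supported iff $s=t\cup u$ with $t\models^-\phi,u\models^-\psi$; $\vee$ supported iff $s=t\cup u$ with $t\models\phi,u\models\psi$, anti-supported iff both are; $\veebar$ supported iff one disjunct is, anti-supported iff both are. Team properties over finite $\mathsf{X}$ are sets of teams $s\subseteq 2^\mathsf{X}$; $\|\phi\|_\mathsf{X}$ is the set of teams supporting $\phi$. $L$ is bicomplete for a class $\mathscr{P}$ of pairs if for every finite $\mathsf{X}$, $\{(\|\phi\|_\mathsf{X},\|\neg\phi\|_\mathsf{X})\mid\phi\in L\}$ equals the pairs of $\mathscr{P}$ over $\mathsf{X}$; bicomplete modulo expressive power if bicomplete for $\mathscr{P}$ restricted to pairs of properties expressible in $L$. -}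

module Defs where

open import Data.Nat using (ℕ; zero; suc)
open import Data.Bool using (Bool; true; false; _∨_)
open import Data.Fin using (Fin)
open import Data.Vec using (Vec; []; _∷_; lookup)
open import Data.Product using (_×_; _,_; ∃; ∃-syntax)
open import Data.Sum using (_⊎_)
open import Data.Unit using (⊤)
open import Relation.Binary.PropositionalEquality using (_≡_)
open import Function.Bundles using (_⇔_)

-- Propositional variables X = {p₀, …, p_{n-1}} are indexed by Fin n.
-- A valuation (possible world) over X is a Vec Bool n.
Val : ℕ → Set
Val n = Vec Bool n

-- A team over X is a subset of 2^X, represented as a complete binary
-- tree of booleans (characteristic function of a set of valuations);
-- this representation has decidable, intensional equality = set equality.
Team : ℕ → Set
Team zero    = Bool
Team (suc n) = Team n × Team n

mem : ∀ {n} → Team n → Val n → Bool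
mem {zero}  b         []          = b
mem {suc n} (s₀ , s₁) (false ∷ w) = mem s₀ w
mem {suc n} (s₀ , s₁) (true  ∷ w) = mem s₁ w

_∈T_ : ∀ {n} → Val n → Team n → Set
w ∈T s = mem s w ≡ true

∅T : ∀ {n} → Team n
∅T {zero}  = false
∅T {suc n} = ∅T , ∅T

_∪T_ : ∀ {n} → Team n → Team n → Team n
_∪T_ {zero}  a b = a ∨ b
_∪T_ {suc n} (a₀ , a₁) (b₀ , b₁) = (a₀ ∪T b₀) , (a₁ ∪T b₁)

data Form (n : ℕ) : Set where
  var  : Fin n → Form n
  bot  : Form n
  neg  : Form n → Form n
  _∧'_ : Form n → Form n → Form n
  _∨'_ : Form n → Form n → Form n
  NE*  : Form n
  _⊻_  : Form n → Form n → Form n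

mutual
  _⊨_ : ∀ {n} → Team n → Form n → Set
  s ⊨ var i   = ∀ w → w ∈T s → lookup w i ≡ true
  s ⊨ bot     = s ≡ ∅T
  s ⊨ neg φ   = s ⊨⁻ φ
  s ⊨ (φ ∧' ψ) = (s ⊨ φ) × (s ⊨ ψ)
  s ⊨ (φ ∨' ψ) = ∃[ t ] ∃[ u ] ((s ≡ t ∪T u) × (t ⊨ φ) × (u ⊨ ψ))
  s ⊨ NE*     = ∃[ w ] (w ∈T s)
  s ⊨ (φ ⊻ ψ) = (s ⊨ φ) ⊎ (s ⊨ ψ)

  _⊨⁻_ : ∀ {n} → Team n → Form n → Set
  s ⊨⁻ var i   = ∀ w → w ∈T s → lookup w i ≡ false
  s ⊨⁻ bot     = ⊤
  s ⊨⁻ neg φ   = s ⊨ φ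
  s ⊨⁻ (φ ∧' ψ) = ∃[ t ] ∃[ u ] ((s ≡ t ∪T u) × (t ⊨⁻ φ) × (u ⊨⁻ ψ))
  s ⊨⁻ (φ ∨' ψ) = (s ⊨⁻ φ) × (s ⊨⁻ ψ)
  s ⊨⁻ NE*     = ∃[ w ] (w ∈T s)
  s ⊨⁻ (φ ⊻ ψ) = (s ⊨⁻ φ) × (s ⊨⁻ ψ)

TeamProp : ℕ → Set
TeamProp n = Team n → Bool

_Defines_ : ∀ {n} → Form n → TeamProp n → Set
φ Defines P = ∀ s → (s ⊨ φ) ⇔ (P s ≡ true)

PairOf : ∀ {n} → Form n → TeamProp n → TeamProp n → Set
PairOf φ P Q = (φ Defines P) × (neg φ Defines Q)

Expressible : ∀ {n} → TeamProp n → Set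
Expressible {n} P = ∃[ φ ] (_Defines_ {n} φ P)

BicompleteAll : ℕ → Set
BicompleteAll n =
  (∀ (φ : Form n) → ∃[ P ] ∃[ Q ] PairOf φ P Q) ×
  (∀ (P Q : TeamProp n) → ∃[ φ ] PairOf φ P Q)

BicompleteAllModExp : ℕ → Set
BicompleteAllModExp n =
  (∀ (φ : Form n) → ∃[ P ] ∃[ Q ] (Expressible P × Expressible Q × PairOf φ P Q)) ×
  (∀ (P Q : TeamProp n) → Expressible P → Expressible Q → ∃[ φ ] PairOf φ P Q)

{-# OPTIONS --safe #-}
-- Support and anti-support are decidable, since there are only finitely many
-- teams over finitely many variables; so every formula determines a pair of
-- properties. Conversely, a team t is defined by the tensor disjunction, over
-- w ∈ t, of the formulas "the team is {w}" (the literals of w together with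
-- NE*), and a property P by the Boolean disjunction ⊻ of these over t ∈ P.
-- Any two formulas φ, ψ then combine into ¬(always ⊻ ¬φ) ⊻ ¬(ψ ∧ ¬never),
-- where always is supported and anti-supported by every team and never is
-- anti-supported by every team but supported by none: its support is that of
-- φ, and its anti-support is the support of ψ.
module Submission where

open import Defs
open import Data.Bool using (Bool; true; false; if_then_else_)
import Data.Bool as Bool
open import Data.Empty using (⊥-elim)
open import Data.Fin using (Fin; zero; suc)
open import Data.List using (List; []; _∷_; map; _++_; filter; foldr)
open import Data.List.Membership.Propositional using (_∈_)
open import Data.List.Membership.Propositional.Properties
  using (∈-map⁺; ∈-++⁺ˡ; ∈-++⁺ʳ; ∈-filter⁺; ∈-filter⁻)
open import Data.List.Relation.Unary.Any using (here)
open import Data.List.Relation.Unary.Any.Properties using (∷↔)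
open import Data.Nat using (ℕ; zero; suc)
open import Data.Product using (_×_; _,_; proj₁; proj₂; ∃; ∃-syntax)
import Data.Product.Properties as Product
open import Data.Sum using (_⊎_; inj₁; inj₂; [_,_])
import Data.Sum as Sum
open import Data.Sum.Function.Propositional using (_⊎-⇔_)
open import Data.Unit using (tt)
open import Data.Vec using (Vec; []; _∷_; lookup)
open import Data.Vec.Properties using (∷-injectiveʳ)
open import Data.Vec.Relation.Binary.Pointwise.Extensional using (ext; Pointwise-≡⇒≡)
open import Function using (_∘_; id)
open import Function.Bundles using (_⇔_; mk⇔; Equivalence)
open import Function.Properties.Equivalence using () renaming (trans to ⇔-trans)
open import Function.Properties.Inverse using (↔⇒⇔)
open import Relation.Binary.Definitions using (DecidableEquality)
open import Relation.Binary.PropositionalEquality using (_≡_; refl; sym; trans; cong; cong₂; subst)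
open import Relation.Nullary using (Dec; yes; no; does; ¬_)
open import Relation.Nullary.Decidable
  using (map′; _×-dec_; _⊎-dec_; _→-dec_; ¬?; decidable-stable)
open import Relation.Unary using (Decidable)

open Equivalence using (to; from)

private
  variable
    k n : ℕ

∉∅T : ∀ (w : Val n) → ¬ w ∈T ∅T
∉∅T {suc n} (false ∷ w) = ∉∅T w
∉∅T {suc n} (true ∷ w)  = ∉∅T w

∈T-∪T : ∀ (s t : Team n) w → w ∈T (s ∪T t) ⇔ (w ∈T s ⊎ w ∈T t)
∈T-∪T {zero}  false t [] = mk⇔ inj₂ [ (λ ()) , id ]
∈T-∪T {zero}  true  t [] = mk⇔ (λ _ → inj₁ refl) (λ _ → refl)
∈T-∪T {suc n} (s₀ , s₁) (t₀ , t₁) (false ∷ w) = ∈T-∪T s₀ t₀ w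
∈T-∪T {suc n} (s₀ , s₁) (t₀ , t₁) (true ∷ w)  = ∈T-∪T s₁ t₁ w

∪T-identityˡ : ∀ (s : Team n) → ∅T ∪T s ≡ s
∪T-identityˡ {zero}  s         = refl
∪T-identityˡ {suc n} (s₀ , s₁) = cong₂ _,_ (∪T-identityˡ s₀) (∪T-identityˡ s₁)

team-ext : ∀ {s t : Team n} → (∀ w → w ∈T s ⇔ w ∈T t) → s ≡ t
team-ext {zero}  {false} {false} h = refl
team-ext {zero}  {false} {true}  h = from (h []) refl
team-ext {zero}  {true}  {false} h = sym (to (h []) refl)
team-ext {zero}  {true}  {true}  h = refl
team-ext {suc n} {s₀ , s₁} {t₀ , t₁} h =
  cong₂ _,_ (team-ext (h ∘ (false ∷_))) (team-ext (h ∘ (true ∷_)))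

_∈T?_ : ∀ (w : Val n) s → Dec (w ∈T s)
w ∈T? s = mem s w Bool.≟ true

singleton : Val n → Team n
singleton []          = true
singleton (false ∷ w) = singleton w , ∅T
singleton (true ∷ w)  = ∅T , singleton w

∈T-singleton : ∀ (u w : Val n) → u ∈T singleton w ⇔ u ≡ w
∈T-singleton []          []          = mk⇔ (λ _ → refl) (λ _ → refl)
∈T-singleton (false ∷ u) (false ∷ w) =
  mk⇔ (cong (false ∷_) ∘ to (∈T-singleton u w)) (from (∈T-singleton u w) ∘ ∷-injectiveʳ)
∈T-singleton (true ∷ u)  (true ∷ w)  =
  mk⇔ (cong (true ∷_) ∘ to (∈T-singleton u w)) (from (∈T-singleton u w) ∘ ∷-injectiveʳ)
∈T-singleton (false ∷ u) (true ∷ w)  = mk⇔ (⊥-elim ∘ ∉∅T u) (λ ())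
∈T-singleton (true ∷ u)  (false ∷ w) = mk⇔ (⊥-elim ∘ ∉∅T u) (λ ())

⟦_⟧ : List (Val n) → Team n
⟦_⟧ = foldr (λ w s → singleton w ∪T s) ∅T

∈T-⟦⟧ : ∀ (ws : List (Val n)) u → u ∈T ⟦ ws ⟧ ⇔ u ∈ ws
∈T-⟦⟧ []       u = mk⇔ (⊥-elim ∘ ∉∅T u) (λ ())
∈T-⟦⟧ (w ∷ ws) u =
  ⇔-trans (∈T-∪T (singleton w) ⟦ ws ⟧ u)
    (⇔-trans (∈T-singleton u w ⊎-⇔ ∈T-⟦⟧ ws u) (↔⇒⇔ (∷↔ (u ≡_))))

valuations : ∀ n → List (Val n)
valuations zero    = [] ∷ []
valuations (suc n) = map (false ∷_) (valuations n) ++ map (true ∷_) (valuations n)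

∈-valuations : ∀ (w : Val n) → w ∈ valuations n
∈-valuations []          = here refl
∈-valuations (false ∷ w) = ∈-++⁺ˡ (∈-map⁺ (false ∷_) (∈-valuations w))
∈-valuations (true ∷ w)  =
  ∈-++⁺ʳ (map (false ∷_) (valuations _)) (∈-map⁺ (true ∷_) (∈-valuations w))

members : Team n → List (Val n)
members {n} s = filter (_∈T? s) (valuations n)

⟦members⟧ : ∀ (s : Team n) → ⟦ members s ⟧ ≡ s
⟦members⟧ {n} s = team-ext λ u →
  ⇔-trans (∈T-⟦⟧ (members s) u)
    (mk⇔ (proj₂ ∘ ∈-filter⁻ (_∈T? s) {xs = valuations n})
         (∈-filter⁺ (_∈T? s) {xs = valuations n} (∈-valuations u)))

Searchable : Set → Set₁
Searchable A = ∀ {P : A → Set} → Decidable P → Dec (∃ P)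

search-∀ : ∀ {A} → Searchable A → ∀ {P : A → Set} → Decidable P → Dec (∀ x → P x)
search-∀ search P? with search (¬? ∘ P?)
... | yes (x , ¬Px) = no λ ∀P → ¬Px (∀P x)
... | no ∄¬P        = yes λ x → decidable-stable (P? x) (λ ¬Px → ∄¬P (x , ¬Px))

searchable-Bool : Searchable Bool
searchable-Bool P? =
  map′ [ (false ,_) , (true ,_) ] (λ { (false , p) → inj₁ p ; (true , p) → inj₂ p })
    (P? false ⊎-dec P? true)

searchable-× : ∀ {A B} → Searchable A → Searchable B → Searchable (A × B)
searchable-× searchA searchB P? =
  map′ (λ (a , b , p) → (a , b) , p) (λ ((a , b) , p) → a , b , p)
    (searchA λ a → searchB λ b → P? (a , b))

searchable-Vec : ∀ {A} → Searchable A → Searchable (Vec A n)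
searchable-Vec {zero}  search P? = map′ ([] ,_) (λ { ([] , p) → p }) (P? [])
searchable-Vec {suc n} search P? =
  map′ (λ (x , xs , p) → x ∷ xs , p) (λ { (x ∷ xs , p) → x , xs , p })
    (search λ x → searchable-Vec search λ xs → P? (x ∷ xs))

searchable-Val : Searchable (Val n)
searchable-Val = searchable-Vec searchable-Bool

searchable-Team : Searchable (Team n)
searchable-Team {zero}  = searchable-Bool
searchable-Team {suc n} = searchable-× searchable-Team searchable-Team

_≟T_ : DecidableEquality (Team n)
_≟T_ {zero}  = Bool._≟_
_≟T_ {suc n} = Product.≡-dec _≟T_ _≟T_

∅T-or-inhabited : ∀ (s : Team n) → s ≡ ∅T ⊎ ∃[ w ] w ∈T s
∅T-or-inhabited s with searchable-Val (_∈T? s)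
... | yes inhabited = inj₂ inhabited
... | no empty      =
  inj₁ (team-ext λ w → mk⇔ (λ w∈s → ⊥-elim (empty (w , w∈s))) (⊥-elim ∘ ∉∅T w))

mutual
  _⊨?_ : ∀ (s : Team n) φ → Dec (s ⊨ φ)
  s ⊨? var i    = search-∀ searchable-Val λ w → w ∈T? s →-dec lookup w i Bool.≟ true
  s ⊨? bot      = s ≟T ∅T
  s ⊨? neg φ    = s ⊨⁻? φ
  s ⊨? (φ ∧' ψ) = s ⊨? φ ×-dec s ⊨? ψ
  s ⊨? (φ ∨' ψ) = searchable-Team λ t → searchable-Team λ u →
                    s ≟T (t ∪T u) ×-dec t ⊨? φ ×-dec u ⊨? ψ
  s ⊨? NE*      = searchable-Val (_∈T? s)
  s ⊨? (φ ⊻ ψ)  = s ⊨? φ ⊎-dec s ⊨? ψ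

  _⊨⁻?_ : ∀ (s : Team n) φ → Dec (s ⊨⁻ φ)
  s ⊨⁻? var i    = search-∀ searchable-Val λ w → w ∈T? s →-dec lookup w i Bool.≟ false
  s ⊨⁻? bot      = yes tt
  s ⊨⁻? neg φ    = s ⊨? φ
  s ⊨⁻? (φ ∧' ψ) = searchable-Team λ t → searchable-Team λ u →
                     s ≟T (t ∪T u) ×-dec t ⊨⁻? φ ×-dec u ⊨⁻? ψ
  s ⊨⁻? (φ ∨' ψ) = s ⊨⁻? φ ×-dec s ⊨⁻? ψ
  s ⊨⁻? NE*      = searchable-Val (_∈T? s)
  s ⊨⁻? (φ ⊻ ψ)  = s ⊨⁻? φ ×-dec s ⊨⁻? ψ

does-⇔ : ∀ {A : Set} (a? : Dec A) → A ⇔ (does a? ≡ true)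
does-⇔ (yes a) = mk⇔ (λ _ → refl) (λ _ → a)
does-⇔ (no ¬a) = mk⇔ (⊥-elim ∘ ¬a) (λ ())

pair-of-formula : ∀ (φ : Form n) → ∃[ P ] ∃[ Q ] PairOf φ P Q
pair-of-formula φ =
  (λ s → does (s ⊨? φ)) , (λ s → does (s ⊨⁻? φ)) ,
  (λ s → does-⇔ (s ⊨? φ)) , (λ s → does-⇔ (s ⊨⁻? φ))

expressible-pair-of-formula :
  ∀ (φ : Form n) → ∃[ P ] ∃[ Q ] (Expressible P × Expressible Q × PairOf φ P Q)
expressible-pair-of-formula φ =
  let P , Q , φ-defines-P , ¬φ-defines-Q = pair-of-formula φ
  in P , Q , (φ , φ-defines-P) , (neg φ , ¬φ-defines-Q) , φ-defines-P , ¬φ-defines-Q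

top : Form n
top = neg bot

nonempty : Form n
nonempty = neg (bot ⊻ NE*)

always : Form n
always = bot ⊻ nonempty

never : Form n
never = nonempty ∧' bot

always⁺ : ∀ (s : Team n) → s ⊨ always
always⁺ s = Sum.map id (tt ,_) (∅T-or-inhabited s)

always⁻ : ∀ (s : Team n) → s ⊨⁻ always
always⁻ s = tt , ∅T-or-inhabited s

never⁺ : ∀ {s : Team n} → ¬ s ⊨ never
never⁺ ((_ , w , w∈s) , refl) = ∉∅T w w∈s

never⁻ : ∀ (s : Team n) → s ⊨⁻ never
never⁻ s = ∅T , s , sym (∪T-identityˡ s) , inj₁ refl , tt

lit : Fin n → Bool → Form n
lit i true  = var i
lit i false = neg (var i)

⊨-lit : ∀ (s : Team n) i b → s ⊨ lit i b ⇔ (∀ w → w ∈T s → lookup w i ≡ b)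
⊨-lit s i true  = mk⇔ id id
⊨-lit s i false = mk⇔ id id

⋀ : (Fin k → Form n) → Form n
⋀ {zero}  φ = top
⋀ {suc k} φ = φ zero ∧' ⋀ (φ ∘ suc)

⊨-⋀ : ∀ (s : Team n) (φ : Fin k → Form n) → s ⊨ ⋀ φ ⇔ (∀ i → s ⊨ φ i)
⊨-⋀ {k = zero}  s φ = mk⇔ (λ _ ()) (λ _ → tt)
⊨-⋀ {k = suc k} s φ =
  mk⇔ (λ { (p , ps) zero → p ; (p , ps) (suc i) → to (⊨-⋀ s (φ ∘ suc)) ps i })
      (λ ps → ps zero , from (⊨-⋀ s (φ ∘ suc)) (ps ∘ suc))

atMost : Val n → Form n
atMost w = ⋀ λ i → lit i (lookup w i)

⊨-atMost : ∀ (s : Team n) w → s ⊨ atMost w ⇔ (∀ u → u ∈T s → u ≡ w)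
⊨-atMost s w = mk⇔
  (λ p u u∈s → Pointwise-≡⇒≡ (ext λ i →
    to (⊨-lit s i (lookup w i)) (to (⊨-⋀ s _) p i) u u∈s))
  (λ h → from (⊨-⋀ s _) λ i →
    from (⊨-lit s i (lookup w i)) λ u u∈s → cong (λ v → lookup v i) (h u u∈s))

point : Val n → Form n
point w = atMost w ∧' NE*

⊨-point : ∀ (s : Team n) w → s ⊨ point w ⇔ s ≡ singleton w
⊨-point s w = mk⇔ to′ from′
  where
  to′ : s ⊨ point w → s ≡ singleton w
  to′ (s⊆w , v , v∈s) = team-ext λ u → mk⇔
    (λ u∈s → from (∈T-singleton u w) (to (⊨-atMost s w) s⊆w u u∈s))
    (λ u∈w → subst (_∈T s)
      (trans (to (⊨-atMost s w) s⊆w v v∈s) (sym (to (∈T-singleton u w) u∈w))) v∈s)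
  from′ : s ≡ singleton w → s ⊨ point w
  from′ refl = from (⊨-atMost s w) (λ u → to (∈T-singleton u w)) ,
               w , from (∈T-singleton w w) refl

exactly : List (Val n) → Form n
exactly = foldr (λ w φ → point w ∨' φ) bot

⊨-exactly : ∀ (s : Team n) ws → s ⊨ exactly ws ⇔ s ≡ ⟦ ws ⟧
⊨-exactly s []       = mk⇔ id id
⊨-exactly s (w ∷ ws) = mk⇔
  (λ (t , u , s≡t∪u , t⊨ , u⊨) →
    trans s≡t∪u (cong₂ _∪T_ (to (⊨-point t w) t⊨) (to (⊨-exactly u ws) u⊨)))
  (λ s≡ → singleton w , ⟦ ws ⟧ , s≡ ,
          from (⊨-point _ w) refl , from (⊨-exactly _ ws) refl)

χ : Team n → Form n
χ t = exactly (members t)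

⊨-χ : ∀ (s t : Team n) → s ⊨ χ t ⇔ s ≡ t
⊨-χ s t = subst (λ t′ → s ⊨ χ t ⇔ s ≡ t′) (⟦members⟧ t) (⊨-exactly s (members t))

⨆ : (Team k → Form n) → Form n
⨆ {zero}  φ = φ false ⊻ φ true
⨆ {suc k} φ = ⨆ λ t₀ → ⨆ λ t₁ → φ (t₀ , t₁)

⊨-⨆ : ∀ (s : Team n) (φ : Team k → Form n) → s ⊨ ⨆ φ ⇔ (∃[ t ] s ⊨ φ t)
⊨-⨆ {k = zero}  s φ =
  mk⇔ [ (false ,_) , (true ,_) ] (λ { (false , p) → inj₁ p ; (true , p) → inj₂ p })
⊨-⨆ {k = suc k} s φ = mk⇔
  (λ p → let t₀ , q = to (⊨-⨆ s _) p ; t₁ , r = to (⊨-⨆ s _) q in (t₀ , t₁) , r)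
  (λ ((t₀ , t₁) , p) → from (⊨-⨆ s _) (t₀ , from (⊨-⨆ s _) (t₁ , p)))

when : Bool → Form n → Form n
when b φ = if b then φ else never

⊨-when : ∀ (s : Team n) b φ → s ⊨ when b φ ⇔ (b ≡ true × s ⊨ φ)
⊨-when s true  φ = mk⇔ (refl ,_) proj₂
⊨-when s false φ = mk⇔ (⊥-elim ∘ never⁺) (λ ())

defining : TeamProp n → Form n
defining P = ⨆ λ t → when (P t) (χ t)

every-property-expressible : ∀ (P : TeamProp n) → Expressible P
every-property-expressible P = defining P , λ s → ⇔-trans (⊨-⨆ s _) (mk⇔
  (λ (t , p) → let Pt , s⊨χt = to (⊨-when s (P t) (χ t)) p
               in subst (λ x → P x ≡ true) (sym (to (⊨-χ s t) s⊨χt)) Pt)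
  (λ Ps → s , from (⊨-when s (P s) (χ s)) (Ps , from (⊨-χ s s) refl)))

pair : Form n → Form n → Form n
pair φ ψ = neg (always ⊻ neg φ) ⊻ neg (ψ ∧' neg never)

⊨-pair : ∀ (s : Team n) φ ψ → s ⊨ pair φ ψ ⇔ s ⊨ φ
⊨-pair s φ ψ = mk⇔
  [ proj₂ , (λ (_ , _ , _ , _ , u⊨never) → ⊥-elim (never⁺ u⊨never)) ]
  (λ s⊨φ → inj₁ (always⁻ s , s⊨φ))

⊨⁻-pair : ∀ (s : Team n) φ ψ → s ⊨⁻ pair φ ψ ⇔ s ⊨ ψ
⊨⁻-pair s φ ψ = mk⇔ (proj₁ ∘ proj₂) (λ s⊨ψ → inj₁ (always⁺ s) , s⊨ψ , never⁻ s)

pair-of-expressible : ∀ {P Q : TeamProp n} → Expressible P → Expressible Q → ∃[ φ ] PairOf φ P Q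
pair-of-expressible (φ , φ-defines-P) (ψ , ψ-defines-Q) =
  pair φ ψ ,
  (λ s → ⇔-trans (⊨-pair s φ ψ) (φ-defines-P s)) ,
  (λ s → ⇔-trans (⊨⁻-pair s φ ψ) (ψ-defines-Q s))

corollary3p26 : ((n : ℕ) → BicompleteAll n) × ((n : ℕ) → BicompleteAllModExp n)
corollary3p26 =
  (λ n → pair-of-formula ,
         λ P Q → pair-of-expressible (every-property-expressible P) (every-property-expressible Q)) ,
  (λ n → expressible-pair-of-formula , λ P Q → pair-of-expressible)
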